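{- $\mathcal{SL}\subseteq\mathcal X_{ij}$ for every $X\in\{A,B,C,D,E,F\}$ and all $1\le i<j\le 5$.
   Context: A zroupoid is an algebra $\langle A,\to,0\rangle$ with $\to$ binary and $0$ a constant; write $x' := x\to 0$. An implication zroupoid ($\mathcal I$-zroupoid) is a zroupoid satisfying (I) $(x\to y)\to z \approx ((z'\to x)\to(y\to z)')'$ and (I$_0$) $0''\approx 0$. $\mathcal S$ is the variety of $\mathcal I$-zroupoids satisfying $x''\approx x$ and $(x\to y')'\approx (y\to x')'$. $\mathcal{SL}$ is the variety of $\mathcal I$-zroupoids satisfying $x'\approx x$ and $x\to y\approx y\to x$ (it is generated by the two-element algebra on $\{0,1\}$ with $0\to0=0$ and $0\to1=1\to0=1\to1=1$). Bol-Moufang identities: the six words A: $xxyz$, B: $xyxz$, C: $xyyz$, D: $xyzx$, E: $xyzy$, F: $xyzz$, and five bracketings of $o_1o_2o_3o_4$: 1: $o_1\to(o_2\to(o_3\to o_4))$; 2: $o_1\to((o_2\to o_3)\to o_4)$; 3: $(o_1\to o_2)\to(o_3\to o_4)$; 4: $(o_1\to(o_2\to o_3))\to o_4$; 5: $((o_1\to o_2)\to o_3)\to o_4$. $(X_{ij})$ is the identity with left side word $X$ bracketed by $i$ and right side word $X$ bracketed by $j$; $\mathcal X_{ij}$ is the subvariety of $\mathcal S$ defined by $(X_{ij})$. -}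

module Defs where

open import Level using (Level) renaming (suc to lsuc)
open import Data.Fin using (Fin; zero; suc)
open import Relation.Binary.PropositionalEquality using (_≡_)
open import Data.Product using (_×_)

record Zroupoid (a : Level) : Set (lsuc a) where
  infixr 5 _⇒_
  field
    Carrier : Set a
    _⇒_     : Carrier → Carrier → Carrier
    𝟘       : Carrier

  _′ : Carrier → Carrier
  x ′ = x ⇒ 𝟘

module _ {a : Level} (Z : Zroupoid a) where
  open Zroupoid Z

  IsIZroupoid : Set a
  IsIZroupoid =
    (∀ x y z → (x ⇒ y) ⇒ z ≡ ((((z ′) ⇒ x) ⇒ (y ⇒ z) ′) ′)) × ((𝟘 ′) ′ ≡ 𝟘)

  IsS : Set a
  IsS = IsIZroupoid × (∀ x → (x ′) ′ ≡ x) × (∀ x y → (x ⇒ y ′) ′ ≡ (y ⇒ x ′) ′)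

  IsSL : Set a
  IsSL = IsIZroupoid × (∀ x → x ′ ≡ x) × (∀ x y → x ⇒ y ≡ y ⇒ x)

data BMWord : Set where
  A B C D E F : BMWord

-- The five bracketings; Fin 5 index k stands for bracketing k+1 of the paper.
bracket : ∀ {a} {X : Set a} → (X → X → X) → Fin 5 → X → X → X → X → X
bracket _⇒_ zero                          o₁ o₂ o₃ o₄ = o₁ ⇒ (o₂ ⇒ (o₃ ⇒ o₄))
bracket _⇒_ (suc zero)                    o₁ o₂ o₃ o₄ = o₁ ⇒ ((o₂ ⇒ o₃) ⇒ o₄)
bracket _⇒_ (suc (suc zero))              o₁ o₂ o₃ o₄ = (o₁ ⇒ o₂) ⇒ (o₃ ⇒ o₄)
bracket _⇒_ (suc (suc (suc zero)))        o₁ o₂ o₃ o₄ = (o₁ ⇒ (o₂ ⇒ o₃)) ⇒ o₄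
bracket _⇒_ (suc (suc (suc (suc zero))))  o₁ o₂ o₃ o₄ = ((o₁ ⇒ o₂) ⇒ o₃) ⇒ o₄

evalBM : ∀ {a} {X : Set a} → (X → X → X) → BMWord → Fin 5 → X → X → X → X
evalBM f A k x y z = bracket f k x x y z
evalBM f B k x y z = bracket f k x y x z
evalBM f C k x y z = bracket f k x y y z
evalBM f D k x y z = bracket f k x y z x
evalBM f E k x y z = bracket f k x y z y
evalBM f F k x y z = bracket f k x y z z

module _ {a : Level} (Z : Zroupoid a) where
  open Zroupoid Z

  SatisfiesBM : BMWord → Fin 5 → Fin 5 → Set a
  SatisfiesBM W i j = ∀ x y z → evalBM _⇒_ W i x y z ≡ evalBM _⇒_ W j x y z

  InX : BMWord → Fin 5 → Fin 5 → Set a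
  InX W i j = IsS Z × SatisfiesBM W i j

module Submission where

-- Idea: in 𝒮ℒ we have x′ = x and → is commutative, so identity (I) collapses
-- to  (x → y) → z = (z → x) → (y → z).  From this one derives that 0 is a
-- left unit, the absorption law (x → z) → z = x → z, and then that → is
-- associative.  For an associative operation every bracketing of a word of
-- length four evaluates to the right-normed product, so any two bracketings
-- of any Bol–Moufang word agree.

open import Defs
open import Level using (Level)
open import Data.Fin using (Fin; _<_; zero; suc)
open import Data.Product using (_,_)
open import Relation.Binary.PropositionalEquality
import Algebra.Definitions as AlgebraDefinitions

module AssociativeBrackets {a} {X : Set a} (_∙_ : X → X → X)
       (assoc : AlgebraDefinitions.Associative {A = X} _≡_ _∙_) where

  bracket-rightNormed : ∀ k o₁ o₂ o₃ o₄ →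
    bracket _∙_ k o₁ o₂ o₃ o₄ ≡ o₁ ∙ (o₂ ∙ (o₃ ∙ o₄))
  bracket-rightNormed zero                         o₁ o₂ o₃ o₄ = refl
  bracket-rightNormed (suc zero)                   o₁ o₂ o₃ o₄ =
    cong (o₁ ∙_) (assoc o₂ o₃ o₄)
  bracket-rightNormed (suc (suc zero))             o₁ o₂ o₃ o₄ =
    assoc o₁ o₂ (o₃ ∙ o₄)
  bracket-rightNormed (suc (suc (suc zero)))       o₁ o₂ o₃ o₄ =
    trans (assoc o₁ (o₂ ∙ o₃) o₄) (cong (o₁ ∙_) (assoc o₂ o₃ o₄))
  bracket-rightNormed (suc (suc (suc (suc zero)))) o₁ o₂ o₃ o₄ =
    trans (assoc (o₁ ∙ o₂) o₃ o₄) (assoc o₁ o₂ (o₃ ∙ o₄))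

  bracket-independent : ∀ i j o₁ o₂ o₃ o₄ →
    bracket _∙_ i o₁ o₂ o₃ o₄ ≡ bracket _∙_ j o₁ o₂ o₃ o₄
  bracket-independent i j o₁ o₂ o₃ o₄ =
    trans (bracket-rightNormed i o₁ o₂ o₃ o₄) (sym (bracket-rightNormed j o₁ o₂ o₃ o₄))

  bolMoufang : ∀ W i j x y z → evalBM _∙_ W i x y z ≡ evalBM _∙_ W j x y z
  bolMoufang A i j x y z = bracket-independent i j x x y z
  bolMoufang B i j x y z = bracket-independent i j x y x z
  bolMoufang C i j x y z = bracket-independent i j x y y z
  bolMoufang D i j x y z = bracket-independent i j x y z x
  bolMoufang E i j x y z = bracket-independent i j x y z y
  bolMoufang F i j x y z = bracket-independent i j x y z z

-- Consequences of (I) together with the two defining identities of 𝒮ℒ.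
module SLArithmetic {a} (Z : Zroupoid a) where
  open Zroupoid Z
  open AlgebraDefinitions {A = Carrier} _≡_ using (Associative; Commutative)

  module _ (I : ∀ x y z → (x ⇒ y) ⇒ z ≡ ((((z ′) ⇒ x) ⇒ (y ⇒ z) ′) ′))
           (prime-trivial : ∀ x → x ′ ≡ x)
           (comm : Commutative _⇒_) where
    open ≡-Reasoning

    I-unprimed : ∀ x y z → (x ⇒ y) ⇒ z ≡ (z ⇒ x) ⇒ (y ⇒ z)
    I-unprimed x y z = begin
      (x ⇒ y) ⇒ z                             ≡⟨ I x y z ⟩
      (((z ′) ⇒ x) ⇒ (y ⇒ z) ′) ′             ≡⟨ prime-trivial _ ⟩
      ((z ′) ⇒ x) ⇒ (y ⇒ z) ′                 ≡⟨ cong₂ (λ u v → (u ⇒ x) ⇒ v)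
                                                   (prime-trivial z) (prime-trivial (y ⇒ z)) ⟩
      (z ⇒ x) ⇒ (y ⇒ z)                       ∎

    zero-leftUnit : ∀ z → 𝟘 ⇒ z ≡ z
    zero-leftUnit z = trans (comm 𝟘 z) (prime-trivial z)

    absorb : ∀ x z → (x ⇒ z) ⇒ z ≡ x ⇒ z
    absorb x z = sym (begin
      x ⇒ z                ≡⟨ cong (_⇒ z) (sym (prime-trivial x)) ⟩
      (x ⇒ 𝟘) ⇒ z          ≡⟨ I-unprimed x 𝟘 z ⟩
      (z ⇒ x) ⇒ (𝟘 ⇒ z)    ≡⟨ cong ((z ⇒ x) ⇒_) (zero-leftUnit z) ⟩
      (z ⇒ x) ⇒ z          ≡⟨ cong (_⇒ z) (comm z x) ⟩
      (x ⇒ z) ⇒ z          ∎)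

    assoc : Associative _⇒_
    assoc x y z = begin
      (x ⇒ y) ⇒ z                     ≡⟨ I-unprimed x y z ⟩
      (z ⇒ x) ⇒ (y ⇒ z)               ≡⟨ I-unprimed z x (y ⇒ z) ⟩
      ((y ⇒ z) ⇒ z) ⇒ (x ⇒ (y ⇒ z))   ≡⟨ cong (_⇒ (x ⇒ (y ⇒ z))) (absorb y z) ⟩
      (y ⇒ z) ⇒ (x ⇒ (y ⇒ z))         ≡⟨ comm (y ⇒ z) (x ⇒ (y ⇒ z)) ⟩
      (x ⇒ (y ⇒ z)) ⇒ (y ⇒ z)         ≡⟨ absorb x (y ⇒ z) ⟩
      x ⇒ (y ⇒ z)                     ∎

SL⊆S : ∀ {a} (Z : Zroupoid a) → IsSL Z → IsS Z
SL⊆S Z (isI , prime-trivial , comm) = isI , involutive , twisted-comm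
  where
  open Zroupoid Z
  open ≡-Reasoning

  involutive : ∀ x → (x ′) ′ ≡ x
  involutive x = trans (prime-trivial (x ′)) (prime-trivial x)

  twisted-comm : ∀ x y → (x ⇒ y ′) ′ ≡ (y ⇒ x ′) ′
  twisted-comm x y = begin
    (x ⇒ y ′) ′   ≡⟨ prime-trivial _ ⟩
    x ⇒ y ′       ≡⟨ cong (x ⇒_) (prime-trivial y) ⟩
    x ⇒ y         ≡⟨ comm x y ⟩
    y ⇒ x         ≡⟨ cong (y ⇒_) (sym (prime-trivial x)) ⟩
    y ⇒ x ′       ≡⟨ sym (prime-trivial _) ⟩
    (y ⇒ x ′) ′   ∎

lemma3p6 : ∀ {a : Level} (Z : Zroupoid a) → IsSL Z →
    (W : BMWord) (i j : Fin 5) → i < j → InX Z W i j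
lemma3p6 Z sl@((I , _) , prime-trivial , comm) W i j _ =
  SL⊆S Z sl , AssociativeBrackets.bolMoufang _⇒_ ⇒-assoc W i j
  where
  open Zroupoid Z using (Carrier; _⇒_)

  ⇒-assoc : AlgebraDefinitions.Associative {A = Carrier} _≡_ _⇒_
  ⇒-assoc = SLArithmetic.assoc Z I prime-trivial comm
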